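{- Let $G$ be a finite simple undirected graph and let $\Omega$ be a potential maximal clique of $G$. If $\Omega$ is not free, then $\Omega = N[v]$ for some vertex $v\in V(G)$.
   Context: A triangulation of $G$ is a chordal graph $H$ with $V(H)=V(G)$ and $E(G)\subseteq E(H)$; it is minimal if no triangulation of $G$ has an edge set that is a proper subset of $E(H)$. A set $\Omega\subseteq V(G)$ is a potential maximal clique (PMC) of $G$ if it is a maximal clique of some minimal triangulation of $G$. A PMC $\Omega$ is free if every vertex of $\Omega$ is adjacent to some vertex of $V(G)\setminus\Omega$. $N[v]=N(v)\cup\{v\}$ denotes the closed neighborhood of $v$. -}

module Defs where

open import Data.Nat using (ℕ; suc; _+_; _∸_)
open import Data.Bool using (Bool; true; false; _∨_)
open import Data.Fin using (Fin; toℕ; _≟_)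
open import Data.Fin.Subset using (Subset; _∈_; _∉_; _⊆_)
open import Data.Vec using (tabulate)
open import Data.Product using (Σ; ∃; _×_; _,_)
open import Data.Sum using (_⊎_)
open import Relation.Nullary using (¬_)
open import Relation.Nullary.Decidable using (⌊_⌋)
open import Relation.Binary.PropositionalEquality using (_≡_; _≢_)
open import Function.Definitions using (Injective)

record Graph (n : ℕ) : Set where
  field
    adj    : Fin n → Fin n → Bool
    sym    : ∀ u v → adj u v ≡ adj v u
    irrefl : ∀ v → adj v v ≡ false
open Graph public

Adj : ∀ {n} → Graph n → Fin n → Fin n → Set
Adj G u v = adj G u v ≡ true

_⊆ᴱ_ : ∀ {n} → Graph n → Graph n → Set
G ⊆ᴱ H = ∀ u v → Adj G u v → Adj H u v

CycNext : (k : ℕ) → Fin k → Fin k → Set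
CycNext k i j = (toℕ j ≡ suc (toℕ i)) ⊎ ((suc (toℕ i) ≡ k) × (toℕ j ≡ 0))

CycConsecutive : (k : ℕ) → Fin k → Fin k → Set
CycConsecutive k i j = CycNext k i j ⊎ CycNext k j i

IsCycle : ∀ {n} → Graph n → (k : ℕ) → (Fin k → Fin n) → Set
IsCycle G k c = Injective _≡_ _≡_ c × (∀ i j → CycNext k i j → Adj G (c i) (c j))

HasChord : ∀ {n} → Graph n → (k : ℕ) → (Fin k → Fin n) → Set
HasChord G k c = Σ (Fin k) λ i → Σ (Fin k) λ j →
  (i ≢ j) × ¬ CycConsecutive k i j × Adj G (c i) (c j)

Chordal : ∀ {n} → Graph n → Set
Chordal {n} G = ∀ (m : ℕ) (c : Fin (4 + m) → Fin n) →
  IsCycle G (4 + m) c → HasChord G (4 + m) c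

IsTriangulation : ∀ {n} → Graph n → Graph n → Set
IsTriangulation G H = Chordal H × (G ⊆ᴱ H)

IsMinimalTriangulation : ∀ {n} → Graph n → Graph n → Set
IsMinimalTriangulation G H =
  IsTriangulation G H ×
  (∀ H' → IsTriangulation G H' → H' ⊆ᴱ H → H ⊆ᴱ H')

IsClique : ∀ {n} → Graph n → Subset n → Set
IsClique G Ω = ∀ u v → u ∈ Ω → v ∈ Ω → u ≢ v → Adj G u v

IsMaximalClique : ∀ {n} → Graph n → Subset n → Set
IsMaximalClique G Ω =
  IsClique G Ω × (∀ Ω' → IsClique G Ω' → Ω ⊆ Ω' → Ω' ⊆ Ω)

IsPMC : ∀ {n} → Graph n → Subset n → Set
IsPMC G Ω = ∃ λ H → IsMinimalTriangulation G H × IsMaximalClique H Ω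

IsFree : ∀ {n} → Graph n → Subset n → Set
IsFree G Ω = ∀ v → v ∈ Ω → ∃ λ u → u ∉ Ω × Adj G v u

N[_]in_ : ∀ {n} → Fin n → Graph n → Subset n
N[ v ]in G = tabulate (λ u → adj G v u ∨ ⌊ u ≟ v ⌋)

-- As Ω is not free, some v ∈ Ω has N(v) ⊆ Ω. Since Ω is a clique of the minimal
-- triangulation H, so is N(v); hence replacing the H-edges at v by the G-edges at v leaves a
-- triangulation (a cycle through v has a chord between the two neighbours of v on it).
-- Minimality of H then forces N_H(v) = N(v), and Ω ⊆ N_H[v] = N[v] ⊆ Ω.
module Submission where

open import Defs hiding (sym)
open import Data.Nat using (ℕ; suc; _+_; _<?_)
open import Data.Nat.Properties using (1+n≢n; m≢1+n+m; ≤∧≮⇒≡)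
open import Data.Bool using (Bool; true; false; _∨_; if_then_else_) renaming (_≟_ to _≟ᵇ_)
open import Data.Bool.Properties using (∨-comm; ∨-zeroʳ; ∨-identityʳ; if-eta)
open import Data.Fin using (Fin; zero; suc; toℕ; fromℕ; fromℕ<; inject₁; _≟_)
open import Data.Fin.Properties using (toℕ-fromℕ; toℕ-fromℕ<; toℕ-inject₁; toℕ<n; any?; ¬∀⟶∃¬)
open import Data.Fin.Subset using (Subset; _∈_; _∉_; _⊆_)
open import Data.Fin.Subset.Properties using (_∈?_; ⊆-antisym)
open import Data.Vec using (lookup)
open import Data.Vec.Properties using (lookup∘tabulate; []=⇒lookup; lookup⇒[]=)
open import Data.Product using (∃; _×_; _,_)
open import Data.Sum using (_⊎_; inj₁; inj₂; [_,_]′)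
open import Function using (_∘_)
open import Relation.Nullary using (¬_; Dec; yes; no; contradiction; ¬?)
open import Relation.Nullary.Decidable using (⌊_⌋; _×-dec_; _→-dec_; decidable-stable)
open import Relation.Binary.PropositionalEquality using (_≡_; _≢_; refl; sym; trans; cong; subst; ≢-sym)

-- CycNext k i j unfolds to SuccMod k (toℕ i) (toℕ j); on ℕ the cases can be split by matching on refl.
SuccMod : ℕ → ℕ → ℕ → Set
SuccMod k a b = (b ≡ suc a) ⊎ ((suc a ≡ k) × (b ≡ 0))

succMod-irrefl : ∀ {m a b} → SuccMod (2 + m) a b → a ≢ b
succMod-irrefl (inj₁ refl) = ≢-sym 1+n≢n
succMod-irrefl (inj₂ (() , refl)) refl

two-steps-apart : ∀ {m a b c} → SuccMod (4 + m) a b → SuccMod (4 + m) b c →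
  a ≢ c × ¬ (SuccMod (4 + m) a c ⊎ SuccMod (4 + m) c a)
two-steps-apart {a = a} (inj₁ refl) (inj₁ refl) = m≢1+n+m a {1} , λ
  { (inj₁ (inj₁ e))        → 1+n≢n e
  ; (inj₁ (inj₂ (_ , ())))
  ; (inj₂ (inj₁ e))        → m≢1+n+m a {2} e
  ; (inj₂ (inj₂ (() , refl))) }
two-steps-apart (inj₁ refl) (inj₂ (refl , refl)) = (λ ()) , λ
  { (inj₁ (inj₁ ()))
  ; (inj₁ (inj₂ (e , _))) → 1+n≢n (sym e)
  ; (inj₂ (inj₁ ()))
  ; (inj₂ (inj₂ (() , _))) }
two-steps-apart (inj₂ (refl , refl)) (inj₁ refl) = (λ ()) , λ
  { (inj₁ (inj₁ ()))
  ; (inj₁ (inj₂ (_ , ())))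
  ; (inj₂ (inj₁ ()))
  ; (inj₂ (inj₂ (() , _))) }
two-steps-apart (inj₂ (refl , refl)) (inj₂ (() , _))

cycNext-succ : ∀ {k} (i : Fin (suc k)) → ∃ λ s → CycNext (suc k) i s
cycNext-succ {k} i with suc (toℕ i) <? suc k
... | yes i+1<k = fromℕ< i+1<k , inj₁ (toℕ-fromℕ< i+1<k)
... | no  i+1≮k = zero , inj₂ (≤∧≮⇒≡ (toℕ<n i) i+1≮k , refl)

cycNext-pred : ∀ {k} (i : Fin (suc k)) → ∃ λ p → CycNext (suc k) p i
cycNext-pred {k} zero    = fromℕ k , inj₂ (cong suc (toℕ-fromℕ k) , refl)
cycNext-pred     (suc j) = inject₁ j , inj₁ (cong suc (sym (toℕ-inject₁ j)))

∨-does⁺ : ∀ x {A : Set} (d : Dec A) → x ≡ true ⊎ A → x ∨ ⌊ d ⌋ ≡ true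
∨-does⁺ x (yes _)  _             = ∨-zeroʳ x
∨-does⁺ x (no _)   (inj₁ x≡true) = trans (∨-identityʳ x) x≡true
∨-does⁺ x (no ¬a)  (inj₂ a)      = contradiction a ¬a

∨-does⁻ : ∀ x {A : Set} (d : Dec A) → x ∨ ⌊ d ⌋ ≡ true → x ≡ true ⊎ A
∨-does⁻ true  _       _ = inj₁ refl
∨-does⁻ false (yes a) _ = inj₂ a
∨-does⁻ false (no _)  ()

module _ {n : ℕ} (G : Graph n) (v : Fin n) where

  lookup-N[] : ∀ u → lookup (N[ v ]in G) u ≡ adj G v u ∨ ⌊ u ≟ v ⌋
  lookup-N[] = lookup∘tabulate _

  ∈N[]⁺ : ∀ {u} → Adj G v u ⊎ u ≡ v → u ∈ N[ v ]in G
  ∈N[]⁺ {u} h = lookup⇒[]= u _ (trans (lookup-N[] u) (∨-does⁺ _ (u ≟ v) h))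

  ∈N[]⁻ : ∀ {u} → u ∈ N[ v ]in G → Adj G v u ⊎ u ≡ v
  ∈N[]⁻ {u} u∈N = ∨-does⁻ _ (u ≟ v) (trans (sym (lookup-N[] u)) ([]=⇒lookup u∈N))

  NeighbourhoodCliqueIn : Graph n → Set
  NeighbourhoodCliqueIn H = ∀ a b → Adj G v a → Adj G v b → a ≢ b → Adj H a b

module Splice {n : ℕ} (G H : Graph n) (v : Fin n) where

  touches : Fin n → Fin n → Bool
  touches a b = ⌊ a ≟ v ⌋ ∨ ⌊ b ≟ v ⌋

  splice : Graph n
  splice = record
    { adj    = λ a b → if touches a b then adj G a b else adj H a b
    ; sym    = symmetric
    ; irrefl = irreflexive
    }
    where
    symmetric : ∀ a b → (if touches a b then adj G a b else adj H a b)
                      ≡ (if touches b a then adj G b a else adj H b a)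
    symmetric a b
      rewrite Graph.sym G a b | Graph.sym H a b | ∨-comm ⌊ a ≟ v ⌋ ⌊ b ≟ v ⌋ = refl

    irreflexive : ∀ a → (if touches a a then adj G a a else adj H a a) ≡ false
    irreflexive a rewrite irrefl G a | irrefl H a = if-eta (touches a a)

  splice-at : ∀ u → adj splice v u ≡ adj G v u
  splice-at u with v ≟ v
  ... | yes _   = refl
  ... | no v≢v = contradiction refl v≢v

  splice-away : ∀ {a b} → a ≢ v → b ≢ v → adj splice a b ≡ adj H a b
  splice-away {a} {b} a≢v b≢v with a ≟ v | b ≟ v
  ... | yes a≡v | _       = contradiction a≡v a≢v
  ... | no _    | yes b≡v = contradiction b≡v b≢v
  ... | no _    | no _    = refl

  splice-from : ∀ a b → adj splice a b ≡ adj G a b ⊎ adj splice a b ≡ adj H a b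
  splice-from a b with touches a b
  ... | true  = inj₁ refl
  ... | false = inj₂ refl

  ⊆ᴱ-splice : G ⊆ᴱ H → G ⊆ᴱ splice
  ⊆ᴱ-splice G⊆H a b ab =
    [ (λ e → trans e ab) , (λ e → trans e (G⊆H a b ab)) ]′ (splice-from a b)

  splice-⊆ᴱ : G ⊆ᴱ H → splice ⊆ᴱ H
  splice-⊆ᴱ G⊆H a b ab =
    [ (λ e → G⊆H a b (trans (sym e) ab)) , (λ e → trans (sym e) ab) ]′ (splice-from a b)

  chord-around-v : NeighbourhoodCliqueIn G v H →
    ∀ {k} (c : Fin (suc (suc k)) → Fin n) → IsCycle splice (suc (suc k)) c →
    ∀ {p i s} → c i ≡ v → CycNext _ p i → CycNext _ i s → p ≢ s → Adj splice (c p) (c s)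
  chord-around-v N-clique c (c-inj , c-edges) {p} {i} {s} cᵢ≡v p→i i→s p≢s =
    trans (splice-away (λ cₚ≡v → step-distinct p→i (trans cₚ≡v (sym cᵢ≡v)))
                       (λ cₛ≡v → step-distinct i→s (trans cᵢ≡v (sym cₛ≡v))))
          (N-clique (c p) (c s) v~cₚ v~cₛ (p≢s ∘ c-inj))
    where
    step-distinct : ∀ {x y} → CycNext _ x y → c x ≢ c y
    step-distinct x→y = succMod-irrefl x→y ∘ cong toℕ ∘ c-inj

    v~cₚ : Adj G v (c p)
    v~cₚ = trans (sym (splice-at (c p)))
                 (subst (λ w → Adj splice w (c p)) cᵢ≡v
                        (trans (Graph.sym splice (c i) (c p)) (c-edges p i p→i)))

    v~cₛ : Adj G v (c s)
    v~cₛ = trans (sym (splice-at (c s)))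
                 (subst (λ w → Adj splice w (c s)) cᵢ≡v (c-edges i s i→s))

  splice-chordal : Chordal H → NeighbourhoodCliqueIn G v H → Chordal splice
  splice-chordal H-chordal N-clique m c cycle with any? (λ i → c i ≟ v)
  ... | yes (i , cᵢ≡v) with cycNext-pred i | cycNext-succ i
  ...   | p , p→i | s , i→s with two-steps-apart {m} p→i i→s
  ...     | toℕp≢toℕs , ¬consecutive =
    p , s , p≢s , ¬consecutive , chord-around-v N-clique c cycle cᵢ≡v p→i i→s p≢s
    where
    p≢s : p ≢ s
    p≢s = toℕp≢toℕs ∘ cong toℕ
  splice-chordal H-chordal N-clique m c (c-inj , c-edges) | no v∉c =
    let (i , j , i≢j , ¬consecutive , cᵢ~cⱼ) =
          H-chordal m c (c-inj , λ i j i→j → trans (sym (away i j)) (c-edges i j i→j))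
    in i , j , i≢j , ¬consecutive , trans (away i j) cᵢ~cⱼ
    where
    away : ∀ i j → adj splice (c i) (c j) ≡ adj H (c i) (c j)
    away i j = splice-away (v∉c ∘ (i ,_)) (v∉c ∘ (j ,_))

minimal⇒no-fill-at : ∀ {n} {G H : Graph n} (v : Fin n) → IsMinimalTriangulation G H →
  NeighbourhoodCliqueIn G v H → ∀ u → Adj H v u → Adj G v u
minimal⇒no-fill-at {G = G} {H} v ((H-chordal , G⊆H) , minimal) N-clique u v~u =
  trans (sym (splice-at u)) (H⊆splice v u v~u)
  where
  open Splice G H v
  H⊆splice : H ⊆ᴱ splice
  H⊆splice =
    minimal splice (splice-chordal H-chordal N-clique , ⊆ᴱ-splice G⊆H) (splice-⊆ᴱ G⊆H)

¬IsFree⇒closed-vertex : ∀ {n} (G : Graph n) (Ω : Subset n) → ¬ IsFree G Ω →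
  ∃ λ v → v ∈ Ω × (∀ u → Adj G v u → u ∈ Ω)
¬IsFree⇒closed-vertex {n} G Ω ¬free with ¬∀⟶∃¬ n _ escapes? ¬free
  where
  escapes? : ∀ v → Dec (v ∈ Ω → ∃ λ u → u ∉ Ω × Adj G v u)
  escapes? v = (v ∈? Ω) →-dec any? (λ u → ¬? (u ∈? Ω) ×-dec (adj G v u ≟ᵇ true))
... | v , ¬escapes with v ∈? Ω
...   | no  v∉Ω = contradiction (λ v∈Ω → contradiction v∈Ω v∉Ω) ¬escapes
...   | yes v∈Ω = v , v∈Ω , λ u v~u →
  decidable-stable (u ∈? Ω) (λ u∉Ω → ¬escapes (λ _ → u , u∉Ω , v~u))

lemma2 : ∀ {n : ℕ} (G : Graph n) (Ω : Subset n) →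
    IsPMC G Ω → ¬ IsFree G Ω → ∃ λ (v : Fin n) → Ω ≡ N[ v ]in G
lemma2 G Ω (H , minimal , Ω-clique , _) ¬free with ¬IsFree⇒closed-vertex G Ω ¬free
... | v , v∈Ω , N⊆Ω = v , ⊆-antisym Ω⊆N[v] N[v]⊆Ω
  where
  N-clique : NeighbourhoodCliqueIn G v H
  N-clique a b v~a v~b = Ω-clique a b (N⊆Ω a v~a) (N⊆Ω b v~b)

  Ω⊆N[v] : Ω ⊆ N[ v ]in G
  Ω⊆N[v] {u} u∈Ω with u ≟ v
  ... | yes u≡v = ∈N[]⁺ G v (inj₂ u≡v)
  ... | no  u≢v = ∈N[]⁺ G v (inj₁ (minimal⇒no-fill-at {G = G} {H} v minimal N-clique u
                                      (Ω-clique v u v∈Ω u∈Ω (≢-sym u≢v))))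

  N[v]⊆Ω : N[ v ]in G ⊆ Ω
  N[v]⊆Ω u∈N = [ N⊆Ω _ , (λ { refl → v∈Ω }) ]′ (∈N[]⁻ G v u∈N)
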